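{- Let $n\geq 1$ and $q\geq 2$ be integers, and let $H(n,q)$ be the Hamming graph. Then $N(H(n,q))=n(q-1)$.
   Context: The Hamming graph $H(n,q)$ has as vertices all words of length $n$ over the alphabet $\{1,\dots,q\}$, two words being adjacent if and only if they differ in exactly one position. For a connected graph $G$, a $t$-address is a $t$-tuple with entries in $\{0,a,b\}$ (with $a,b$ two distinct non-zero symbols), and an addressing of length $t$ of $G$ is an assignment of $t$-addresses to the vertices of $G$ such that for any two vertices $u,v$ the graph distance $d_G(u,v)$ equals the number of positions in which one of the addresses of $u,v$ equals $a$ and the other equals $b$. $N(G)$ denotes the minimum length of an addressing of $G$ (equivalently, the minimum number of complete bipartite subgraphs whose edge sets partition the edge multiset of the distance multigraph of $G$, in which each pair $u,v$ is joined by $d_G(u,v)$ parallel edges). -}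

module Defs where

open import Data.Nat using (ℕ; zero; suc; _+_; _≤_)
open import Data.Fin using (Fin)
open import Data.Fin.Properties using (_≟_)
open import Data.Vec using (Vec; []; _∷_)
open import Data.Product using (Σ; _×_)
open import Relation.Binary.PropositionalEquality using (_≡_)
open import Relation.Nullary using (yes; no)

data Walk {V : Set} (Adj : V → V → Set) : V → V → ℕ → Set where
  here : ∀ {u} → Walk Adj u u zero
  step : ∀ {u w v k} → Adj u w → Walk Adj w v k → Walk Adj u v (suc k)

IsDistance : {V : Set} → (V → V → Set) → V → V → ℕ → Set
IsDistance Adj u v d = Walk Adj u v d × (∀ k → Walk Adj u v k → d ≤ k)

diffCount : ∀ {q n} → Vec (Fin q) n → Vec (Fin q) n → ℕ
diffCount [] [] = zero
diffCount (x ∷ xs) (y ∷ ys) with x ≟ y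
... | yes _ = diffCount xs ys
... | no  _ = suc (diffCount xs ys)

HammingAdj : ∀ n q → Vec (Fin q) n → Vec (Fin q) n → Set
HammingAdj n q u v = diffCount u v ≡ 1

data Sym : Set where
  𝟎 a b : Sym

symDist : Sym → Sym → ℕ
symDist a b = 1
symDist b a = 1
symDist _ _ = 0

addrDist : ∀ {t} → Vec Sym t → Vec Sym t → ℕ
addrDist [] [] = zero
addrDist (x ∷ xs) (y ∷ ys) = symDist x y + addrDist xs ys

IsAddressing : {V : Set} → (V → V → Set) → (t : ℕ) → (V → Vec Sym t) → Set
IsAddressing Adj t f = ∀ u v → IsDistance Adj u v (addrDist (f u) (f v))

IsMinAddressingLength : {V : Set} → (V → V → Set) → ℕ → Set
IsMinAddressingLength {V} Adj m =
  Σ (V → Vec Sym m) (IsAddressing Adj m) ×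
  (∀ t → (f : V → Vec Sym t) → IsAddressing Adj t f → m ≤ t)

-- Upper bound: an addressing of length q − 1 of the complete graph on the alphabet, used
-- independently in every position, is an addressing of H(n,q) of length n(q − 1).
--
-- Lower bound, in the manner of Graham and Pollak: for an addressing of length t the distance
-- matrix is D = Σₗ (aₗ bₗᵀ + bₗ aₗᵀ), where aₗ, bₗ are the indicator vectors of the symbols a, b
-- in position l, so wᵀ D w = 0 for every w orthogonal to a₁, …, aₜ. Restrict to the
-- N + 1 = n(q − 1) + 1 words with at most one nonzero letter. If t < N, some w ≠ 0 is orthogonal
-- to a₁, …, aₜ and to the all-ones vector. But d(u,v) = n − Σ_{j,c} [u_j = c] [v_j = c], so for
-- such w we get wᵀ D w = − Σ_{j,c} (Σᵢ wᵢ [vᵢ(j) = c])², and for c ≠ 0 the inner sum is the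
-- entry of w at the word with letter c at position j. Hence w vanishes on the words with one
-- nonzero letter, and then, summing to 0, at the zero word as well.

module Submission where

open import Defs
open import Data.Bool using (if_then_else_)
open import Data.Fin using (Fin; zero; suc)
open import Data.Fin.Properties using (_≟_)
open import Data.Product using (∃-syntax; _,_)
open import Data.Vec using (Vec; []; _∷_; replicate; _++_; lookup)
open import Function using (_∘_)
open import Relation.Nullary using (¬_; does; yes; no)
open import Relation.Nullary.Decidable using (dec-true; dec-false)
open import Relation.Nullary.Negation using (contradiction)
open import Relation.Binary.PropositionalEquality
  using (_≡_; _≢_; refl; sym; trans; cong; cong₂; subst; module ≡-Reasoning)

module HammingMetric where

  open import Data.Nat using (ℕ; suc; _+_; _≤_; z≤n; s≤s)
  open import Data.Nat.Properties
    using (≤-trans; ≤-reflexive; ≤-antisym; +-mono-≤; +-commutativeSemigroup; module ≤-Reasoning)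
  open import Algebra.Properties.CommutativeSemigroup +-commutativeSemigroup using (interchange)

  mismatch : ∀ {q} → Fin q → Fin q → ℕ
  mismatch x y = if does (x ≟ y) then 0 else 1

  mismatch-self : ∀ {q} (x : Fin q) → mismatch x x ≡ 0
  mismatch-self x rewrite dec-true (x ≟ x) refl = refl

  mismatch-≢ : ∀ {q} {x y : Fin q} → x ≢ y → mismatch x y ≡ 1
  mismatch-≢ {x = x} {y} x≢y rewrite dec-false (x ≟ y) x≢y = refl

  mismatch-triangle : ∀ {q} (x y z : Fin q) → mismatch x z ≤ mismatch x y + mismatch y z
  mismatch-triangle x y z with x ≟ z | x ≟ y | y ≟ z
  ... | yes _  | _        | _        = z≤n
  ... | no _   | no _     | _        = s≤s z≤n
  ... | no _   | yes _    | no _     = s≤s z≤n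
  ... | no x≢z | yes refl | yes refl = contradiction refl x≢z

  diffCount-∷ : ∀ {q n} (x y : Fin q) (xs ys : Vec (Fin q) n) →
                diffCount (x ∷ xs) (y ∷ ys) ≡ mismatch x y + diffCount xs ys
  diffCount-∷ x y xs ys with x ≟ y
  ... | yes _ = refl
  ... | no _  = refl

  diffCount-self : ∀ {q n} (u : Vec (Fin q) n) → diffCount u u ≡ 0
  diffCount-self []       = refl
  diffCount-self (x ∷ xs) =
    trans (diffCount-∷ x x xs xs) (cong₂ _+_ (mismatch-self x) (diffCount-self xs))

  diffCount-triangle : ∀ {q n} (u v w : Vec (Fin q) n) →
                       diffCount u w ≤ diffCount u v + diffCount v w
  diffCount-triangle []       []       []       = z≤n
  diffCount-triangle (x ∷ xs) (y ∷ ys) (z ∷ zs) = begin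
    diffCount (x ∷ xs) (z ∷ zs)
      ≡⟨ diffCount-∷ x z xs zs ⟩
    mismatch x z + diffCount xs zs
      ≤⟨ +-mono-≤ (mismatch-triangle x y z) (diffCount-triangle xs ys zs) ⟩
    (mismatch x y + mismatch y z) + (diffCount xs ys + diffCount ys zs)
      ≡⟨ interchange (mismatch x y) (mismatch y z) (diffCount xs ys) (diffCount ys zs) ⟩
    (mismatch x y + diffCount xs ys) + (mismatch y z + diffCount ys zs)
      ≡⟨ sym (cong₂ _+_ (diffCount-∷ x y xs ys) (diffCount-∷ y z ys zs)) ⟩
    diffCount (x ∷ xs) (y ∷ ys) + diffCount (y ∷ ys) (z ∷ zs) ∎
    where open ≤-Reasoning

  walk-length-≥ : ∀ {q n} {u v : Vec (Fin q) n} {k} →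
                  Walk (HammingAdj n q) u v k → diffCount u v ≤ k
  walk-length-≥ {u = u} here = ≤-reflexive (diffCount-self u)
  walk-length-≥ {u = u} {v} (step {w = w} u~w w⇝v) =
    ≤-trans (diffCount-triangle u w v) (+-mono-≤ (≤-reflexive u~w) (walk-length-≥ w⇝v))

  consWalk : ∀ {q n} (x : Fin q) {xs ys : Vec (Fin q) n} {k} →
            Walk (HammingAdj n q) xs ys k → Walk (HammingAdj (suc n) q) (x ∷ xs) (x ∷ ys) k
  consWalk x here = here
  consWalk x (step {u = u} {w = w} u~w w⇝v) =
    step (trans (diffCount-∷ x x u w) (cong₂ _+_ (mismatch-self x) u~w)) (consWalk x w⇝v)

  geodesic : ∀ {q n} (u v : Vec (Fin q) n) → Walk (HammingAdj n q) u v (diffCount u v)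
  geodesic []       []       = here
  geodesic (x ∷ xs) (y ∷ ys) with x ≟ y
  ... | yes refl = consWalk x (geodesic xs ys)
  ... | no x≢y   = step changeHead (consWalk y (geodesic xs ys))
    where
    changeHead : diffCount (x ∷ xs) (y ∷ xs) ≡ 1
    changeHead = trans (diffCount-∷ x y xs xs) (cong₂ _+_ (mismatch-≢ x≢y) (diffCount-self xs))

  diffCount-isDistance : ∀ {q n} (u v : Vec (Fin q) n) →
                         IsDistance (HammingAdj n q) u v (diffCount u v)
  diffCount-isDistance u v = geodesic u v , λ _ → walk-length-≥

  isDistance-unique : ∀ {V : Set} {Adj : V → V → Set} {u v : V} {d e : ℕ} →
                      IsDistance Adj u v d → IsDistance Adj u v e → d ≡ e
  isDistance-unique (walk₁ , shortest₁) (walk₂ , shortest₂) =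
    ≤-antisym (shortest₁ _ walk₂) (shortest₂ _ walk₁)

module UpperBound where

  open HammingMetric
  open import Data.Nat using (zero; suc; _+_; _*_)
  open import Data.Nat.Properties using (+-assoc)

  -- The complete graph on r + 1 vertices as an edge-disjoint union of r stars.
  cliqueAddress : ∀ r → Fin (suc r) → Vec Sym r
  cliqueAddress zero    _       = []
  cliqueAddress (suc r) zero    = b ∷ replicate r 𝟎
  cliqueAddress (suc r) (suc x) = a ∷ cliqueAddress r x

  addrDist-𝟎ˡ : ∀ {r} (s : Vec Sym r) → addrDist (replicate r 𝟎) s ≡ 0
  addrDist-𝟎ˡ []      = refl
  addrDist-𝟎ˡ (_ ∷ s) = addrDist-𝟎ˡ s

  addrDist-𝟎ʳ : ∀ {r} (s : Vec Sym r) → addrDist s (replicate r 𝟎) ≡ 0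
  addrDist-𝟎ʳ []      = refl
  addrDist-𝟎ʳ (𝟎 ∷ s) = addrDist-𝟎ʳ s
  addrDist-𝟎ʳ (a ∷ s) = addrDist-𝟎ʳ s
  addrDist-𝟎ʳ (b ∷ s) = addrDist-𝟎ʳ s

  addrDist-cliqueAddress : ∀ r (x y : Fin (suc r)) →
                           addrDist (cliqueAddress r x) (cliqueAddress r y) ≡ mismatch x y
  addrDist-cliqueAddress zero    zero    zero    = refl
  addrDist-cliqueAddress (suc r) zero    zero    = addrDist-𝟎ˡ (replicate r 𝟎)
  addrDist-cliqueAddress (suc r) zero    (suc y) = cong suc (addrDist-𝟎ˡ (cliqueAddress r y))
  addrDist-cliqueAddress (suc r) (suc x) zero    = cong suc (addrDist-𝟎ʳ (cliqueAddress r x))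
  addrDist-cliqueAddress (suc r) (suc x) (suc y) = addrDist-cliqueAddress r x y

  addrDist-++ : ∀ {k l} (s t : Vec Sym k) (s′ t′ : Vec Sym l) →
                addrDist (s ++ s′) (t ++ t′) ≡ addrDist s t + addrDist s′ t′
  addrDist-++ []      []      s′ t′ = refl
  addrDist-++ (x ∷ s) (y ∷ t) s′ t′ =
    trans (cong (symDist x y +_) (addrDist-++ s t s′ t′)) (sym (+-assoc (symDist x y) _ _))

  hammingAddress : ∀ {n r} → Vec (Fin (suc r)) n → Vec Sym (n * r)
  hammingAddress         []       = []
  hammingAddress {r = r} (x ∷ xs) = cliqueAddress r x ++ hammingAddress xs

  addrDist-hammingAddress : ∀ {n r} (u v : Vec (Fin (suc r)) n) →
                            addrDist (hammingAddress u) (hammingAddress v) ≡ diffCount u v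
  addrDist-hammingAddress         []       []       = refl
  addrDist-hammingAddress {r = r} (x ∷ xs) (y ∷ ys) = begin
    addrDist (cliqueAddress r x ++ hammingAddress xs) (cliqueAddress r y ++ hammingAddress ys)
      ≡⟨ addrDist-++ (cliqueAddress r x) (cliqueAddress r y) (hammingAddress xs) (hammingAddress ys) ⟩
    addrDist (cliqueAddress r x) (cliqueAddress r y) + addrDist (hammingAddress xs) (hammingAddress ys)
      ≡⟨ cong₂ _+_ (addrDist-cliqueAddress r x y) (addrDist-hammingAddress xs ys) ⟩
    mismatch x y + diffCount xs ys
      ≡⟨ sym (diffCount-∷ x y xs ys) ⟩
    diffCount (x ∷ xs) (y ∷ ys) ∎
    where open ≡-Reasoning

  hammingAddress-isAddressing : ∀ {n r} →
                                IsAddressing (HammingAdj n (suc r)) (n * r) hammingAddress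
  hammingAddress-isAddressing u v =
    subst (IsDistance _ u v) (sym (addrDist-hammingAddress u v)) (diffCount-isDistance u v)

module IntegerLinearAlgebra where

  open import Data.Nat using (zero; suc; z≤n; s≤s) renaming (_<_ to _<ℕ_)
  open import Data.Nat.Properties using (m+n≡0⇒m≡0; m+n≡0⇒n≡0)
  open import Data.Integer using (ℤ; +_; -[1+_]; 0ℤ; 1ℤ; _+_; _*_; -_; _-_; _≤_; +≤+)
  open import Data.Integer.Properties
    using (+-*-semiring; +-identityˡ; +-identityʳ; +-inverseʳ; +-injective; +-mono-≤;
           *-comm; *-identityˡ; *-identityʳ; *-zeroʳ; pos-*; i*j≡0⇒i≡0∨j≡0)
    renaming (_≟_ to _≟ℤ_)
  open import Data.Integer.Tactic.RingSolver using (solve-∀)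
  open import Algebra.Properties.Semiring.Sum +-*-semiring
    using (sum; sum-cong-≗; sum-replicate-zero; ∑-distrib-+; ∑-comm; *-distribˡ-sum; *-distribʳ-sum)
  open import Data.Vec.Functional using (Vector)
  open import Data.Fin.Properties using (any?; punchIn-punchOut)
  open import Data.Fin using (punchIn; punchOut)
  open import Data.Sum using ([_,_]′)
  open import Data.Product using (_×_)
  open import Function using (id)
  open import Relation.Nullary using (¬?)
  open import Relation.Nullary.Decidable using (decidable-stable)
  open ≡-Reasoning

  δ : ∀ {m} → Fin m → Fin m → ℤ
  δ i k = if does (i ≟ k) then 1ℤ else 0ℤ

  δ-cong : ∀ {m p} {i k : Fin m} {i′ k′ : Fin p} →
           (i ≡ k → i′ ≡ k′) → (i′ ≡ k′ → i ≡ k) → δ i k ≡ δ i′ k′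
  δ-cong {i = i} {k} {i′} {k′} to from with i ≟ k | i′ ≟ k′
  ... | yes _   | yes _    = refl
  ... | no _    | no _     = refl
  ... | yes i≡k | no i′≢k′ = contradiction (to i≡k) i′≢k′
  ... | no i≢k  | yes i′≡k′ = contradiction (from i′≡k′) i≢k

  infix 7 _∙_
  _∙_ : ∀ {m} → Vector ℤ m → Vector ℤ m → ℤ
  u ∙ v = sum λ i → u i * v i

  ∙-comm : ∀ {m} (u v : Vector ℤ m) → u ∙ v ≡ v ∙ u
  ∙-comm u v = sum-cong-≗ λ i → *-comm (u i) (v i)

  sum-zero : ∀ {m} {f : Vector ℤ m} → (∀ i → f i ≡ 0ℤ) → sum f ≡ 0ℤ
  sum-zero {m} f≡0 = trans (sum-cong-≗ f≡0) (sum-replicate-zero m)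

  basis : ∀ {m} → Fin m → Vector ℤ m
  basis k i = δ i k

  basis-∙ : ∀ {m} (k : Fin m) (w : Vector ℤ m) → basis k ∙ w ≡ w k
  basis-∙ {suc m} zero    w = begin
    1ℤ * w zero + sum (λ i → 0ℤ * w (suc i))
      ≡⟨ cong₂ _+_ (*-identityˡ (w zero)) (sum-zero {m} λ _ → refl) ⟩
    w zero + 0ℤ
      ≡⟨ +-identityʳ (w zero) ⟩
    w zero ∎
  basis-∙ {suc m} (suc k) w = trans (+-identityˡ _) (basis-∙ k (w ∘ suc))

  -- Fraction-free Gaussian elimination of the first unknown, with pivot row p.
  eliminateWith : ∀ {m} → Vector ℤ (suc m) → Vector ℤ (suc m) → Vector ℤ m
  eliminateWith p s i = p zero * s (suc i) - s zero * p (suc i)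

  backSubstitute : ∀ {m} → Vector ℤ (suc m) → Vector ℤ m → Vector ℤ (suc m)
  backSubstitute p h zero    = - ((p ∘ suc) ∙ h)
  backSubstitute p h (suc i) = p zero * h i

  ∙-backSubstitute : ∀ {m} (p s : Vector ℤ (suc m)) (h : Vector ℤ m) →
                     s ∙ backSubstitute p h ≡ eliminateWith p s ∙ h
  ∙-backSubstitute p s h = begin
    s zero * - ((p ∘ suc) ∙ h) + sum (λ i → s (suc i) * (p zero * h i))
      ≡⟨ cong (_+_ (s zero * - ((p ∘ suc) ∙ h))) (trans
           (sum-cong-≗ λ i → swap (s (suc i)) (p zero) (h i))
           (sym (*-distribˡ-sum (p zero) (λ i → s (suc i) * h i)))) ⟩
    s zero * - ((p ∘ suc) ∙ h) + p zero * ((s ∘ suc) ∙ h)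
      ≡⟨ rearrange (s zero) (p zero) ((p ∘ suc) ∙ h) ((s ∘ suc) ∙ h) ⟩
    p zero * ((s ∘ suc) ∙ h) + - s zero * ((p ∘ suc) ∙ h)
      ≡⟨ cong₂ _+_ (*-distribˡ-sum (p zero) (λ i → s (suc i) * h i))
                   (*-distribˡ-sum (- s zero) (λ i → p (suc i) * h i)) ⟩
    sum (λ i → p zero * (s (suc i) * h i)) + sum (λ i → - s zero * (p (suc i) * h i))
      ≡⟨ sym (∑-distrib-+ (λ i → p zero * (s (suc i) * h i)) (λ i → - s zero * (p (suc i) * h i))) ⟩
    sum (λ i → p zero * (s (suc i) * h i) + - s zero * (p (suc i) * h i))
      ≡⟨ sum-cong-≗ (λ i → collect (p zero) (s (suc i)) (s zero) (p (suc i)) (h i)) ⟩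
    eliminateWith p s ∙ h ∎
    where
    swap : ∀ x c y → x * (c * y) ≡ c * (x * y)
    swap = solve-∀
    rearrange : ∀ s₀ c P S → s₀ * - P + c * S ≡ c * S + - s₀ * P
    rearrange = solve-∀
    collect : ∀ c x s₀ y z → c * (x * z) + - s₀ * (y * z) ≡ (c * x - s₀ * y) * z
    collect = solve-∀

  eliminateWith-self : ∀ {m} (p : Vector ℤ (suc m)) (h : Vector ℤ m) → eliminateWith p p ∙ h ≡ 0ℤ
  eliminateWith-self p h = sum-zero λ i → cong (_* h i) (+-inverseʳ (p zero * p (suc i)))

  nonzeroKernelVector : ∀ {k m} → k <ℕ m → (A : Fin k → Vector ℤ m) →
                        ∃[ w ] (∃[ i ] w i ≢ 0ℤ) × (∀ r → A r ∙ w ≡ 0ℤ)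
  nonzeroKernelVector {zero}  {suc m} _ A = basis zero , (zero , λ ()) , λ ()
  nonzeroKernelVector {suc k} {suc m} (s≤s k<m) A with any? (λ r → ¬? (A r zero ≟ℤ 0ℤ))
  ... | no noPivot = basis zero , (zero , λ ()) , λ r →
    trans (∙-comm (A r) (basis zero)) (trans (basis-∙ zero (A r))
      (decidable-stable (A r zero ≟ℤ 0ℤ) λ Arzero≢0 → noPivot (r , Arzero≢0)))
  ... | yes (j , pivot≢0)
    with nonzeroKernelVector k<m (λ r → eliminateWith (A j) (A (punchIn j r)))
  ... | h , (i , hᵢ≢0) , h⊥ = backSubstitute (A j) h , (suc i , nonzero) , orthogonal
    where
    nonzero : A j zero * h i ≢ 0ℤ
    nonzero = [ pivot≢0 , hᵢ≢0 ]′ ∘ i*j≡0⇒i≡0∨j≡0 (A j zero)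
    orthogonal : ∀ r → A r ∙ backSubstitute (A j) h ≡ 0ℤ
    orthogonal r with j ≟ r
    ... | yes refl = trans (∙-backSubstitute (A j) (A j) h) (eliminateWith-self (A j) h)
    ... | no j≢r   = subst (λ r → A r ∙ backSubstitute (A j) h ≡ 0ℤ) (punchIn-punchOut j≢r)
      (trans (∙-backSubstitute (A j) (A (punchIn j (punchOut j≢r))) h) (h⊥ (punchOut j≢r)))

  quadForm : ∀ {m} → Vector ℤ m → (Fin m → Fin m → ℤ) → ℤ
  quadForm w M = sum λ i → sum λ k → w i * M i k * w k

  quadForm-cong : ∀ {m} (w : Vector ℤ m) {M N : Fin m → Fin m → ℤ} →
                  (∀ i k → M i k ≡ N i k) → quadForm w M ≡ quadForm w N
  quadForm-cong w M≡N = sum-cong-≗ λ i → sum-cong-≗ λ k → cong (λ x → w i * x * w k) (M≡N i k)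

  quadForm-+ : ∀ {m} (w : Vector ℤ m) (M N : Fin m → Fin m → ℤ) →
               quadForm w (λ i k → M i k + N i k) ≡ quadForm w M + quadForm w N
  quadForm-+ w M N = begin
    quadForm w (λ i k → M i k + N i k)
      ≡⟨ sum-cong-≗ (λ i → trans (sum-cong-≗ λ k → distrib (w i) (M i k) (N i k) (w k))
           (∑-distrib-+ (λ k → w i * M i k * w k) (λ k → w i * N i k * w k))) ⟩
    sum (λ i → sum (λ k → w i * M i k * w k) + sum (λ k → w i * N i k * w k))
      ≡⟨ ∑-distrib-+ (λ i → sum λ k → w i * M i k * w k) (λ i → sum λ k → w i * N i k * w k) ⟩
    quadForm w M + quadForm w N ∎
    where
    distrib : ∀ x m n y → x * (m + n) * y ≡ x * m * y + x * n * y
    distrib = solve-∀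

  quadForm-∑ : ∀ {m p} (w : Vector ℤ m) (M : Fin p → Fin m → Fin m → ℤ) →
               quadForm w (λ i k → sum λ l → M l i k) ≡ sum λ l → quadForm w (M l)
  quadForm-∑ w M = begin
    quadForm w (λ i k → sum λ l → M l i k)
      ≡⟨ sum-cong-≗ (λ i → sum-cong-≗ λ k → pull (w i) (w k) (λ l → M l i k)) ⟩
    (sum λ i → sum λ k → sum λ l → w i * M l i k * w k)
      ≡⟨ sum-cong-≗ (λ i → ∑-comm λ k l → w i * M l i k * w k) ⟩
    (sum λ i → sum λ l → sum λ k → w i * M l i k * w k)
      ≡⟨ ∑-comm (λ i l → sum λ k → w i * M l i k * w k) ⟩
    (sum λ l → quadForm w (M l)) ∎
    where
    pull : ∀ {p} x y (f : Vector ℤ p) → x * sum f * y ≡ sum λ l → x * f l * y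
    pull x y f = trans (cong (_* y) (*-distribˡ-sum x f)) (*-distribʳ-sum y (λ l → x * f l))

  quadForm-outer : ∀ {m} (w u v : Vector ℤ m) →
                   quadForm w (λ i k → u i * v k) ≡ (u ∙ w) * (v ∙ w)
  quadForm-outer w u v = begin
    quadForm w (λ i k → u i * v k)
      ≡⟨ sum-cong-≗ (λ i → sum-cong-≗ λ k → regroup (w i) (u i) (v k) (w k)) ⟩
    (sum λ i → sum λ k → (u i * w i) * (v k * w k))
      ≡⟨ sum-cong-≗ (λ i → sym (*-distribˡ-sum (u i * w i) (λ k → v k * w k))) ⟩
    (sum λ i → (u i * w i) * (v ∙ w))
      ≡⟨ sym (*-distribʳ-sum (v ∙ w) (λ i → u i * w i)) ⟩
    (u ∙ w) * (v ∙ w) ∎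
    where
    regroup : ∀ x y z t → x * (y * z) * t ≡ (y * x) * (z * t)
    regroup = solve-∀

  quadForm-const : ∀ {m} (w : Vector ℤ m) (x : ℤ) →
                   (λ _ → 1ℤ) ∙ w ≡ 0ℤ → quadForm w (λ _ _ → x) ≡ 0ℤ
  quadForm-const w x 1⊥w = begin
    quadForm w (λ _ _ → x)                    ≡⟨ quadForm-cong w (λ _ _ → sym (*-identityʳ x)) ⟩
    quadForm w (λ _ _ → x * 1ℤ)               ≡⟨ quadForm-outer w (λ _ → x) (λ _ → 1ℤ) ⟩
    ((λ _ → x) ∙ w) * ((λ _ → 1ℤ) ∙ w)        ≡⟨ cong (((λ _ → x) ∙ w) *_) 1⊥w ⟩
    ((λ _ → x) ∙ w) * 0ℤ                      ≡⟨ *-zeroʳ ((λ _ → x) ∙ w) ⟩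
    0ℤ                                        ∎

  square-nonneg : ∀ x → 0ℤ ≤ x * x
  square-nonneg (+ n)    = subst (0ℤ ≤_) (pos-* n n) (+≤+ z≤n)
  square-nonneg -[1+ n ] = +≤+ z≤n

  nonneg-+-≡0 : ∀ {x y} → 0ℤ ≤ x → 0ℤ ≤ y → x + y ≡ 0ℤ → x ≡ 0ℤ × y ≡ 0ℤ
  nonneg-+-≡0 {+ m} (+≤+ _) (+≤+ _) x+y≡0 =
    cong +_ (m+n≡0⇒m≡0 m (+-injective x+y≡0)) , cong +_ (m+n≡0⇒n≡0 m (+-injective x+y≡0))

  sum-nonneg : ∀ {m} (f : Vector ℤ m) → (∀ i → 0ℤ ≤ f i) → 0ℤ ≤ sum f
  sum-nonneg {zero}  f f≥0 = +≤+ z≤n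
  sum-nonneg {suc m} f f≥0 = +-mono-≤ (f≥0 zero) (sum-nonneg (f ∘ suc) (f≥0 ∘ suc))

  sum-nonneg-≡0 : ∀ {m} (f : Vector ℤ m) → (∀ i → 0ℤ ≤ f i) → sum f ≡ 0ℤ → ∀ i → f i ≡ 0ℤ
  sum-nonneg-≡0 {suc m} f f≥0 Σf≡0 i
    with nonneg-+-≡0 (f≥0 zero) (sum-nonneg (f ∘ suc) (f≥0 ∘ suc)) Σf≡0 | i
  ... | head≡0 , _      | zero  = head≡0
  ... | _      , tail≡0 | suc i = sum-nonneg-≡0 (f ∘ suc) (f≥0 ∘ suc) tail≡0 i

  sumOfSquares-≡0 : ∀ {m} (f : Vector ℤ m) → sum (λ i → f i * f i) ≡ 0ℤ → ∀ i → f i ≡ 0ℤ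
  sumOfSquares-≡0 f Σ≡0 i =
    [ id , id ]′ (i*j≡0⇒i≡0∨j≡0 (f i) (sum-nonneg-≡0 (λ i → f i * f i) (square-nonneg ∘ f) Σ≡0 i))

module LowerBound where

  open HammingMetric
  open IntegerLinearAlgebra
  import Data.Nat as ℕ
  open import Data.Nat using (ℕ; suc; s≤s)
  open import Data.Nat.Properties using (≮⇒≥)
  open import Data.Integer using (ℤ; +_; 0ℤ; 1ℤ; _+_; _*_)
  open import Data.Integer.Properties
    using (+-*-semiring; pos-+; +-identityˡ; +-identityʳ; *-identityˡ; *-zeroʳ; +-commutativeSemigroup)
  open import Algebra.Properties.CommutativeSemigroup +-commutativeSemigroup using (interchange)
  open import Algebra.Properties.Semiring.Sum +-*-semiring using (sum; sum-cong-≗)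
  open import Data.Fin using (combine; quotient; remainder)
  open import Data.Fin.Properties using (suc-injective; remQuot-combine; combine-remQuot)
  open import Data.Product using (proj₁; proj₂)
  open import Data.Vec using (_[_]≔_)
  open import Data.Vec.Properties using (lookup-replicate; lookup∘update; lookup∘update′)
  open import Data.Vec.Functional as Vector using (Vector)
  open ≡-Reasoning

  isA : Sym → ℤ
  isA a = 1ℤ
  isA _ = 0ℤ

  isB : Sym → ℤ
  isB b = 1ℤ
  isB _ = 0ℤ

  symDist-split : ∀ x y → + symDist x y ≡ isA x * isB y + isB x * isA y
  symDist-split 𝟎 _ = refl
  symDist-split a 𝟎 = refl
  symDist-split a a = refl
  symDist-split a b = refl
  symDist-split b 𝟎 = refl
  symDist-split b a = refl
  symDist-split b b = refl

  addrDist-∑ : ∀ {t} (s s′ : Vec Sym t) →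
               + addrDist s s′ ≡ sum λ l → + symDist (lookup s l) (lookup s′ l)
  addrDist-∑ []      []       = refl
  addrDist-∑ (x ∷ s) (y ∷ s′) =
    trans (pos-+ (symDist x y) (addrDist s s′)) (cong (_+_ (+ symDist x y)) (addrDist-∑ s s′))

  aRow : ∀ {m t} → (Fin m → Vec Sym t) → Fin t → Vector ℤ m
  aRow G l i = isA (lookup (G i) l)

  bRow : ∀ {m t} → (Fin m → Vec Sym t) → Fin t → Vector ℤ m
  bRow G l i = isB (lookup (G i) l)

  -- Position l of the addresses contributes aRow l ⊗ bRow l + bRow l ⊗ aRow l to the distance matrix.
  quadForm-addrDist : ∀ {m t} (G : Fin m → Vec Sym t) (w : Vector ℤ m) →
                      (∀ l → aRow G l ∙ w ≡ 0ℤ) → quadForm w (λ i k → + addrDist (G i) (G k)) ≡ 0ℤ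
  quadForm-addrDist {m} {t} G w a⊥w = begin
    quadForm w (λ i k → + addrDist (G i) (G k))
      ≡⟨ quadForm-cong w (λ i k → trans (addrDist-∑ (G i) (G k))
           (sum-cong-≗ λ l → symDist-split (lookup (G i) l) (lookup (G k) l))) ⟩
    quadForm w (λ i k → sum λ l → cross l i k)
      ≡⟨ quadForm-∑ w cross ⟩
    (sum λ l → quadForm w (cross l))
      ≡⟨ sum-zero crossTerm≡0 ⟩
    0ℤ ∎
    where
    cross : Fin t → Fin m → Fin m → ℤ
    cross l i k = aRow G l i * bRow G l k + bRow G l i * aRow G l k
    crossTerm≡0 : ∀ l → quadForm w (cross l) ≡ 0ℤ
    crossTerm≡0 l = begin
      quadForm w (cross l)
        ≡⟨ quadForm-+ w (λ i k → aRow G l i * bRow G l k) (λ i k → bRow G l i * aRow G l k) ⟩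
      quadForm w (λ i k → aRow G l i * bRow G l k) + quadForm w (λ i k → bRow G l i * aRow G l k)
        ≡⟨ cong₂ _+_ (quadForm-outer w (aRow G l) (bRow G l)) (quadForm-outer w (bRow G l) (aRow G l)) ⟩
      (aRow G l ∙ w) * (bRow G l ∙ w) + (bRow G l ∙ w) * (aRow G l ∙ w)
        ≡⟨ cong₂ (λ x y → x * (bRow G l ∙ w) + (bRow G l ∙ w) * y) (a⊥w l) (a⊥w l) ⟩
      0ℤ * (bRow G l ∙ w) + (bRow G l ∙ w) * 0ℤ
        ≡⟨ cong (_+_ 0ℤ) (*-zeroʳ (bRow G l ∙ w)) ⟩
      0ℤ ∎

  hasLetter : ∀ {m q n} → (Fin m → Vec (Fin q) n) → Fin n → Fin q → Vector ℤ m
  hasLetter π j c i = δ c (lookup (π i) j)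

  mismatch-+-δ : ∀ {q} (x y : Fin q) → + mismatch x y + δ x y ≡ 1ℤ
  mismatch-+-δ x y with x ≟ y
  ... | yes _ = refl
  ... | no _  = refl

  diffCount-+-agreement : ∀ {q n} (u v : Vec (Fin q) n) →
    + diffCount u v + (sum λ j → sum λ c → δ c (lookup u j) * δ c (lookup v j)) ≡ + n
  diffCount-+-agreement                []       []       = refl
  diffCount-+-agreement {n = suc n} (x ∷ xs) (y ∷ ys) = begin
    + diffCount (x ∷ xs) (y ∷ ys) + (basis x ∙ basis y + agreement)
      ≡⟨ cong (λ d → + d + (basis x ∙ basis y + agreement)) (diffCount-∷ x y xs ys) ⟩
    + (mismatch x y ℕ.+ diffCount xs ys) + (basis x ∙ basis y + agreement)
      ≡⟨ cong (λ z → z + (basis x ∙ basis y + agreement)) (pos-+ (mismatch x y) (diffCount xs ys)) ⟩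
    (+ mismatch x y + + diffCount xs ys) + (basis x ∙ basis y + agreement)
      ≡⟨ interchange (+ mismatch x y) (+ diffCount xs ys) (basis x ∙ basis y) agreement ⟩
    (+ mismatch x y + basis x ∙ basis y) + (+ diffCount xs ys + agreement)
      ≡⟨ cong₂ _+_ (trans (cong (_+_ (+ mismatch x y)) (basis-∙ x (basis y))) (mismatch-+-δ x y))
                   (diffCount-+-agreement xs ys) ⟩
    + suc n ∎
    where
    agreement : ℤ
    agreement = sum λ j → sum λ c → δ c (lookup xs j) * δ c (lookup ys j)

  quadForm-diffCount : ∀ {m q n} (π : Fin m → Vec (Fin q) n) (w : Vector ℤ m) →
    quadForm w (λ i k → + diffCount (π i) (π k))
      + (sum λ j → sum λ c → (hasLetter π j c ∙ w) * (hasLetter π j c ∙ w))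
    ≡ quadForm w (λ _ _ → + n)
  quadForm-diffCount {m} {q} {n} π w = sym (begin
    quadForm w (λ _ _ → + n)
      ≡⟨ quadForm-cong w (λ i k → sym (diffCount-+-agreement (π i) (π k))) ⟩
    quadForm w (λ i k → D i k + agreement i k)
      ≡⟨ quadForm-+ w D agreement ⟩
    quadForm w D + quadForm w agreement
      ≡⟨ cong (_+_ (quadForm w D)) (trans (quadForm-∑ w λ j i k → sum λ c → letterPair j c i k)
           (sum-cong-≗ λ j → trans (quadForm-∑ w (letterPair j))
           (sum-cong-≗ λ c → quadForm-outer w (hasLetter π j c) (hasLetter π j c)))) ⟩
    quadForm w D + (sum λ j → sum λ c → (hasLetter π j c ∙ w) * (hasLetter π j c ∙ w)) ∎)
    where
    D : Fin m → Fin m → ℤ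
    D i k = + diffCount (π i) (π k)
    letterPair : Fin n → Fin q → Fin m → Fin m → ℤ
    letterPair j c i k = hasLetter π j c i * hasLetter π j c k
    agreement : Fin m → Fin m → ℤ
    agreement i k = sum λ j → sum λ c → letterPair j c i k

  module _ {n r : ℕ} where

    -- The zero word and the n · r words with a single nonzero letter; point 1 + combine j c
    -- carries the letter c + 1 at position j.
    single : Fin n → Fin (suc r) → Vec (Fin (suc r)) n
    single j y = replicate n zero [ j ]≔ y

    starPoint : Fin (suc (n ℕ.* r)) → Vec (Fin (suc r)) n
    starPoint zero    = replicate n zero
    starPoint (suc i) = single (quotient {n} r i) (suc (remainder {n} r i))

    starPoint-combine : (j : Fin n) (c : Fin r) → lookup (starPoint (suc (combine j c))) j ≡ suc c
    starPoint-combine j c =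
      trans (cong (λ jc → lookup (single (proj₁ jc) (suc (proj₂ jc))) j) (remQuot-combine j c))
            (lookup∘update j (replicate n zero) (suc c))

    starPoint-hasLetter : (i : Fin (suc (n ℕ.* r))) (j : Fin n) (c : Fin r) →
                          suc c ≡ lookup (starPoint i) j → i ≡ suc (combine j c)
    starPoint-hasLetter zero j c c≡ = contradiction (trans c≡ (lookup-replicate j zero)) λ ()
    starPoint-hasLetter (suc i) j c c≡ with quotient {n} r i ≟ j
    ... | yes refl = cong suc (trans (sym (combine-remQuot {n} r i))
          (cong (combine j) (sym (suc-injective (trans c≡ (lookup∘update j (replicate n zero) _))))))
    ... | no q≢j   = contradiction
          (trans c≡ (trans (lookup∘update′ (q≢j ∘ sym) (replicate n zero) _) (lookup-replicate j zero))) λ ()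

    hasLetter-starPoint : (w : Vector ℤ (suc (n ℕ.* r))) (j : Fin n) (c : Fin r) →
                          hasLetter starPoint j (suc c) ∙ w ≡ w (suc (combine j c))
    hasLetter-starPoint w j c = trans
      (sum-cong-≗ λ i → cong (_* w i)
        (δ-cong (starPoint-hasLetter i j c) λ { refl → sym (starPoint-combine j c) }))
      (basis-∙ (suc (combine j c)) w)

    starDistance-definite : (w : Vector ℤ (suc (n ℕ.* r))) → (λ _ → 1ℤ) ∙ w ≡ 0ℤ →
      quadForm w (λ i k → + diffCount (starPoint i) (starPoint k)) ≡ 0ℤ → ∀ i → w i ≡ 0ℤ
    starDistance-definite w 1⊥w Q≡0 = vanishes
      where
      letterSum : Fin n → Fin (suc r) → ℤ
      letterSum j c = hasLetter starPoint j c ∙ w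
      squares : ℤ
      squares = sum λ j → sum λ c → letterSum j c * letterSum j c
      squares≡0 : squares ≡ 0ℤ
      squares≡0 = begin
        squares
          ≡⟨ sym (+-identityˡ squares) ⟩
        0ℤ + squares
          ≡⟨ cong (λ x → x + squares) (sym Q≡0) ⟩
        quadForm w (λ i k → + diffCount (starPoint i) (starPoint k)) + squares
          ≡⟨ quadForm-diffCount starPoint w ⟩
        quadForm w (λ _ _ → + n)
          ≡⟨ quadForm-const w (+ n) 1⊥w ⟩
        0ℤ ∎
      letterSum≡0 : ∀ j c → letterSum j c ≡ 0ℤ
      letterSum≡0 j = sumOfSquares-≡0 (letterSum j)
        (sum-nonneg-≡0 (λ j → sum λ c → letterSum j c * letterSum j c)
          (λ j → sum-nonneg (λ c → letterSum j c * letterSum j c) (square-nonneg ∘ letterSum j))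
          squares≡0 j)
      vanishes : ∀ i → w i ≡ 0ℤ
      vanishes (suc i) = begin
        w (suc i)              ≡⟨ cong (w ∘ suc) (sym (combine-remQuot {n} r i)) ⟩
        w (suc (combine j c))  ≡⟨ sym (hasLetter-starPoint w j c) ⟩
        letterSum j (suc c)    ≡⟨ letterSum≡0 j (suc c) ⟩
        0ℤ                     ∎
        where
        j : Fin n
        j = quotient r i
        c : Fin r
        c = remainder {n} r i
      vanishes zero = begin
        w zero
          ≡⟨ sym (trans (cong₂ _+_ (*-identityˡ (w zero)) (sum-zero tail≡0)) (+-identityʳ (w zero))) ⟩
        1ℤ * w zero + sum (λ i → 1ℤ * w (suc i))
          ≡⟨ 1⊥w ⟩
        0ℤ ∎
        where
        tail≡0 : ∀ i → 1ℤ * w (suc i) ≡ 0ℤ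
        tail≡0 i = trans (*-identityˡ (w (suc i))) (vanishes (suc i))

  addrDist≡diffCount : ∀ {n q t} (f : Vec (Fin q) n → Vec Sym t) →
                       IsAddressing (HammingAdj n q) t f → ∀ u v → addrDist (f u) (f v) ≡ diffCount u v
  addrDist≡diffCount f f-addr u v = isDistance-unique (f-addr u v) (diffCount-isDistance u v)

  noShortAddressing : ∀ {n r t} (f : Vec (Fin (suc r)) n → Vec Sym t) →
                      t ℕ.< n ℕ.* r → ¬ IsAddressing (HammingAdj n (suc r)) t f
  noShortAddressing {n} {r} f t<N f-addr
    with nonzeroKernelVector (s≤s t<N) ((λ _ → 1ℤ) Vector.∷ aRow (f ∘ starPoint))
  ... | w , (i , wᵢ≢0) , w⊥ = wᵢ≢0 (starDistance-definite {n} {r} w (w⊥ zero) distanceForm≡0 i)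
    where
    distanceForm≡0 : quadForm w (λ i k → + diffCount (starPoint {n} {r} i) (starPoint k)) ≡ 0ℤ
    distanceForm≡0 = trans
      (quadForm-cong w λ i k → cong +_ (sym (addrDist≡diffCount f f-addr (starPoint i) (starPoint k))))
      (quadForm-addrDist (f ∘ starPoint) w (w⊥ ∘ suc))

  addressingLength-≥ : ∀ {n r t} (f : Vec (Fin (suc r)) n → Vec Sym t) →
                       IsAddressing (HammingAdj n (suc r)) t f → n ℕ.* r ℕ.≤ t
  addressingLength-≥ f f-addr = ≮⇒≥ λ t<N → noShortAddressing f t<N f-addr

open UpperBound using (hammingAddress; hammingAddress-isAddressing)
open LowerBound using (addressingLength-≥)
open import Data.Nat using (ℕ; suc; _*_; _∸_; _≤_; s≤s)

-- The lower bound holds for every n.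
mainTheorem1 : (n q : ℕ) → 1 ≤ n → 2 ≤ q →
    IsMinAddressingLength (HammingAdj n q) (n * (q ∸ 1))
mainTheorem1 n (suc (suc r)) _ (s≤s (s≤s _)) =
  (hammingAddress , hammingAddress-isAddressing) , λ _ → addressingLength-≥
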